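{- For any multigraph $G$ of maximum degree $\Delta$ that does not contain $k$ vertex-disjoint edges every two of which are joined by an edge, the strong clique number of $G$ satisfies $\omega_2'(G)\le\frac32(k-1)\Delta$.
   Context: Multigraphs may have parallel edges; degree counts multiplicity. Two edges are joined by an edge if some edge of $G$ has one endpoint in common with each. A strong clique is a set of edges every two of which share an endpoint or are joined by an edge; $\omega_2'(G)$ is the maximum size of a strong clique. -}

module Defs where

open import Data.Nat using (ℕ; _≤_)
open import Data.Fin using (Fin; _≟_)
open import Data.Fin.Subset using (Subset; _∈_)
open import Data.List using (List; length; filter; allFin)
open import Data.Product using (Σ; ∃; _×_; _,_)
open import Data.Sum using (_⊎_)
open import Relation.Nullary using (¬_)
open import Relation.Nullary.Decidable using (_⊎-dec_)
open import Relation.Binary.PropositionalEquality using (_≡_; _≢_)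

-- A finite loopless multigraph: vertices Fin n, edges Fin m, each edge
-- has two (distinct) endpoints; parallel edges are allowed since
-- different edge indices may have the same endpoints.
record Multigraph : Set where
  field
    n     : ℕ
    m     : ℕ
    end₁  : Fin m → Fin n
    end₂  : Fin m → Fin n
    loopless : ∀ e → end₁ e ≢ end₂ e

module _ (G : Multigraph) where
  open Multigraph G

  _IncidentTo_ : Fin n → Fin m → Set
  v IncidentTo e = (v ≡ end₁ e) ⊎ (v ≡ end₂ e)

  degree : Fin n → ℕ
  degree v = length (filter (λ e → (v ≟ end₁ e) ⊎-dec (v ≟ end₂ e)) (allFin m))

  MaxDegree≤ : ℕ → Set
  MaxDegree≤ Δ = ∀ v → degree v ≤ Δ

  ShareEndpoint : Fin m → Fin m → Set
  ShareEndpoint e f = ∃ λ v → (v IncidentTo e) × (v IncidentTo f)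

  VertexDisjoint : Fin m → Fin m → Set
  VertexDisjoint e f = ¬ ShareEndpoint e f

  Joined : Fin m → Fin m → Set
  Joined e f = ∃ λ g →
      ((end₁ g IncidentTo e) × (end₂ g IncidentTo f))
    ⊎ ((end₂ g IncidentTo e) × (end₁ g IncidentTo f))

  StrongClique : Subset m → Set
  StrongClique S = ∀ e f → e ∈ S → f ∈ S → e ≢ f →
    ShareEndpoint e f ⊎ Joined e f

  HasJoinedMatching : ℕ → Set
  HasJoinedMatching k = Σ (Fin k → Fin m) λ h → ∀ i j → i ≢ j →
    VertexDisjoint (h i) (h j) × Joined (h i) (h j)

-- Let S be a strong clique of a multigraph G of maximum degree Δ.  Any
-- vertex-disjoint edges of S are pairwise joined by an edge, so a matching
-- inside S of size k would be a joined matching; hence every matching in S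
-- has fewer than k edges.  Grow a matching M = {u₁v₁, …, u_jv_j} in S by two
-- moves until neither applies:
--   * add an edge of S with both ends uncovered by M;
--   * replace uᵢvᵢ by two edges of S that are "pendant" at uᵢ and at vᵢ
--     (their other ends are uncovered) and have distinct far ends.
-- Such a stable matching has j ≤ k - 1 edges, every edge of S has a covered
-- end, and for each i the pendant S-edges at uᵢ and vᵢ all pass through a
-- single vertex ("centre").  Give the edge e the weight w_i(e) counting its
-- incidences with uᵢ, vᵢ plus the pendancies of e at uᵢ, vᵢ.  Every edge of S
-- gets total weight ≥ 2 (the covering lemma), while for each i the S-edges
-- carry weight ≤ deg uᵢ + deg vᵢ + deg(centre) ≤ 3Δ.  Double counting gives
-- 2|S| ≤ 3jΔ ≤ 3(k-1)Δ.
module Submission where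

open import Defs
open import Data.Nat using (ℕ; zero; suc; _+_; _*_; _∸_; _≤_; _<_; z≤n; s≤s)
open import Data.Nat.Properties
  using (≤-refl; ≤-trans; ≤-reflexive; +-mono-≤; +-monoˡ-≤; *-monoˡ-≤; m≤m+n;
         m≤n+m; m<m+n; +-suc; +-comm; +-identityʳ; +-assoc; *-comm; *-assoc;
         *-distribˡ-+; +-*-semiring; module ≤-Reasoning)
open import Data.Bool using (true; false; if_then_else_)
open import Data.Fin using (Fin; zero; suc; _≟_)
open import Data.Fin.Properties using (any?)
open import Data.Fin.Subset using (Subset; ∣_∣; _∈_; inside; outside)
open import Data.Fin.Subset.Properties using (_∈?_)
open import Data.Vec using ([]; _∷_)
open import Data.List using (length; filter; tabulate)
open import Data.Product using (Σ; ∃; ∃-syntax; _×_; _,_; proj₁; proj₂)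
open import Data.Sum using (_⊎_; inj₁; inj₂; [_,_]′)
open import Data.Empty using (⊥-elim)
open import Function using (_∘_)
open import Relation.Nullary using (¬_; Dec; yes; no; does)
open import Relation.Nullary.Decidable using (_⊎-dec_; _×-dec_; ¬?)
open import Relation.Unary using (Pred; Decidable)
open import Relation.Binary.PropositionalEquality
  using (_≡_; _≢_; refl; sym; trans; cong; cong₂; subst)
open import Algebra.Properties.Semiring.Sum +-*-semiring
  using (sum; ∑-comm; ∑-distrib-+; *-distribˡ-sum; sum-cong-≗; sum-remove)

sum-mono : ∀ {n} {f g : Fin n → ℕ} → (∀ i → f i ≤ g i) → sum f ≤ sum g
sum-mono {zero}  f≤g = z≤n
sum-mono {suc n} f≤g = +-mono-≤ (f≤g zero) (sum-mono (f≤g ∘ suc))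

sum-≤-* : ∀ {n} c {f : Fin n → ℕ} → (∀ i → f i ≤ c) → sum f ≤ n * c
sum-≤-* {zero}  c f≤c = z≤n
sum-≤-* {suc n} c f≤c = +-mono-≤ (f≤c zero) (sum-≤-* c (f≤c ∘ suc))

term≤sum : ∀ {n} (f : Fin n → ℕ) i → f i ≤ sum f
term≤sum {suc n} f i = ≤-trans (m≤m+n (f i) _) (≤-reflexive (sym (sum-remove f)))

two-terms≤sum : ∀ {n} (f : Fin n → ℕ) {i i'} → i ≢ i' → f i + f i' ≤ sum f
two-terms≤sum f {zero}  {zero}   i≢i' = ⊥-elim (i≢i' refl)
two-terms≤sum f {zero}  {suc i'} i≢i' = +-mono-≤ ≤-refl (term≤sum (f ∘ suc) i')
two-terms≤sum f {suc i} {zero}   i≢i' =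
  ≤-trans (≤-reflexive (+-comm (f (suc i)) (f zero))) (+-mono-≤ ≤-refl (term≤sum (f ∘ suc) i))
two-terms≤sum f {suc i} {suc i'} i≢i' =
  ≤-trans (two-terms≤sum (f ∘ suc) (i≢i' ∘ cong suc)) (m≤n+m _ (f zero))

𝟙 : ∀ {p} {P : Set p} → Dec P → ℕ
𝟙 d = if does d then 1 else 0

𝟙-yes : ∀ {p} {P : Set p} (d : Dec P) → P → 𝟙 d ≡ 1
𝟙-yes (yes _)  _ = refl
𝟙-yes (no ¬p)  p = ⊥-elim (¬p p)

𝟙-+-≤ : ∀ {p q r} {P : Set p} {Q : Set q} {R : Set r}
        (dP : Dec P) (dQ : Dec Q) (dR : Dec R) →
        ¬ (P × Q) → (P → R) → (Q → R) → 𝟙 dP + 𝟙 dQ ≤ 𝟙 dR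
𝟙-+-≤ (yes p) (yes q) _       ¬pq _   _   = ⊥-elim (¬pq (p , q))
𝟙-+-≤ (yes p) (no _)  (yes _) _   _   _   = ≤-refl
𝟙-+-≤ (yes p) (no _)  (no ¬r) _   p→r _   = ⊥-elim (¬r (p→r p))
𝟙-+-≤ (no _)  (yes q) (yes _) _   _   _   = ≤-refl
𝟙-+-≤ (no _)  (yes q) (no ¬r) _   _   q→r = ⊥-elim (¬r (q→r q))
𝟙-+-≤ (no _)  (no _)  _       _   _   _   = z≤n

𝟙-guard : ∀ {p} {P : Set p} (d : Dec P) {X Y : ℕ} → (P → X ≤ Y) → 𝟙 d * X ≤ 𝟙 d * Y
𝟙-guard (yes p) X≤Y = +-mono-≤ (X≤Y p) z≤n
𝟙-guard (no _)  _   = z≤n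

𝟙-*-≤ : ∀ {p} {P : Set p} (d : Dec P) X → 𝟙 d * X ≤ X
𝟙-*-≤ (yes _) X = ≤-reflexive (+-identityʳ X)
𝟙-*-≤ (no _)  X = z≤n

length-filter-tabulate : ∀ {a p} {A : Set a} {P : Pred A p} (P? : Decidable P) {n}
  (f : Fin n → A) → length (filter P? (tabulate f)) ≡ sum (λ i → 𝟙 (P? (f i)))
length-filter-tabulate P? {zero}  f = refl
length-filter-tabulate P? {suc n} f with does (P? (f zero))
... | true  = cong suc (length-filter-tabulate P? (f ∘ suc))
... | false = length-filter-tabulate P? (f ∘ suc)

∣∣-as-sum : ∀ {n} (S : Subset n) → ∣ S ∣ ≡ sum (λ e → 𝟙 (e ∈? S))
∣∣-as-sum []            = refl
∣∣-as-sum (inside ∷ S)  = cong suc (∣∣-as-sum S)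
∣∣-as-sum (outside ∷ S) = ∣∣-as-sum S

all-or-witness : ∀ {n a b} {A : Fin n → Set a} {B : Set b} →
                 (∀ i → A i ⊎ B) → (∀ i → A i) ⊎ B
all-or-witness {zero}  alt = inj₁ (λ ())
all-or-witness {suc n} alt with alt zero | all-or-witness (alt ∘ suc)
... | inj₂ b | _      = inj₂ b
... | inj₁ _ | inj₂ b = inj₂ b
... | inj₁ a | inj₁ as = inj₁ λ { zero → a ; (suc i) → as i }

module Incidence (G : Multigraph) where
  open Multigraph G

  Inc : Fin n → Fin m → Set
  Inc = _IncidentTo_ G

  incident? : ∀ x e → Dec (Inc x e)
  incident? x e = (x ≟ end₁ e) ⊎-dec (x ≟ end₂ e)

  ι : Fin n → Fin m → ℕ
  ι x e = 𝟙 (incident? x e)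

  incidences≤Δ : ∀ {Δ} → MaxDegree≤ G Δ → ∀ x → sum (ι x) ≤ Δ
  incidences≤Δ maxdeg x =
    ≤-trans (≤-reflexive (sym (length-filter-tabulate (incident? x) (λ e → e)))) (maxdeg x)

  HasEnds : Fin m → Fin n → Fin n → Set
  HasEnds e x y = (x ≡ end₁ e × y ≡ end₂ e) ⊎ (x ≡ end₂ e × y ≡ end₁ e)

  hasEnds? : ∀ e x y → Dec (HasEnds e x y)
  hasEnds? e x y = ((x ≟ end₁ e) ×-dec (y ≟ end₂ e)) ⊎-dec ((x ≟ end₂ e) ×-dec (y ≟ end₁ e))

  ends-incident₁ : ∀ {e x y} → HasEnds e x y → Inc x e
  ends-incident₁ (inj₁ (refl , refl)) = inj₁ refl
  ends-incident₁ (inj₂ (refl , refl)) = inj₂ refl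

  ends-incident₂ : ∀ {e x y} → HasEnds e x y → Inc y e
  ends-incident₂ (inj₁ (refl , refl)) = inj₂ refl
  ends-incident₂ (inj₂ (refl , refl)) = inj₁ refl

  ends-distinct : ∀ {e x y} → HasEnds e x y → x ≢ y
  ends-distinct {e} (inj₁ (refl , refl)) = loopless e
  ends-distinct {e} (inj₂ (refl , refl)) = loopless e ∘ sym

  ends-only : ∀ {e x y z} → HasEnds e x y → Inc z e → z ≡ x ⊎ z ≡ y
  ends-only (inj₁ (refl , refl)) (inj₁ refl) = inj₁ refl
  ends-only (inj₁ (refl , refl)) (inj₂ refl) = inj₂ refl
  ends-only (inj₂ (refl , refl)) (inj₁ refl) = inj₂ refl
  ends-only (inj₂ (refl , refl)) (inj₂ refl) = inj₁ refl

  disjoint-sym : ∀ {e f} → VertexDisjoint G e f → VertexDisjoint G f e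
  disjoint-sym e∩f=∅ (x , x∈f , x∈e) = e∩f=∅ (x , x∈e , x∈f)

module Matchings (G : Multigraph) (S : Subset (Multigraph.m G)) where
  open Multigraph G
  open Incidence G

  record Matching (j : ℕ) : Set where
    field
      edge     : Fin j → Fin m
      inS      : ∀ i → edge i ∈ S
      disjoint : ∀ {i i'} → i ≢ i' → VertexDisjoint G (edge i) (edge i')
  open Matching

  empty : Matching 0
  empty = record { edge = λ () ; inS = λ () ; disjoint = λ { {()} } }

  -- In a strong clique, disjoint edges must be joined, so a matching is a
  -- joined matching.
  clique-matching-joined : StrongClique G S → ∀ {k} → Matching k → HasJoinedMatching G k
  clique-matching-joined clique M = edge M , λ i i' i≢i' → disjoint M i≢i' , joined i≢i'
    where
    distinct : ∀ {i i'} → i ≢ i' → edge M i ≢ edge M i'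
    distinct {i} i≢i' same = disjoint M i≢i' (end₁ (edge M i) , inj₁ refl , inj₁ (cong end₁ same))
    joined : ∀ {i i'} → i ≢ i' → Joined G (edge M i) (edge M i')
    joined {i} {i'} i≢i' with clique (edge M i) (edge M i') (inS M i) (inS M i') (distinct i≢i')
    ... | inj₁ share   = ⊥-elim (disjoint M i≢i' share)
    ... | inj₂ joined′ = joined′

  extend : ∀ {j} (M : Matching j) {e} → e ∈ S →
           (∀ i → VertexDisjoint G e (edge M i)) → Matching (suc j)
  extend {j} M {e} e∈S avoids = record { edge = edge′ ; inS = inS′ ; disjoint = disjoint′ }
    where
    edge′ : Fin (suc j) → Fin m
    edge′ zero    = e
    edge′ (suc i) = edge M i
    inS′ : ∀ i → edge′ i ∈ S
    inS′ zero    = e∈S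
    inS′ (suc i) = inS M i
    disjoint′ : ∀ {a b} → a ≢ b → VertexDisjoint G (edge′ a) (edge′ b)
    disjoint′ {zero}  {zero}  a≢b = ⊥-elim (a≢b refl)
    disjoint′ {zero}  {suc b} _   = avoids b
    disjoint′ {suc a} {zero}  _   = disjoint-sym (avoids a)
    disjoint′ {suc a} {suc b} a≢b = disjoint M (a≢b ∘ cong suc)

  replace : ∀ {j} (M : Matching j) (i : Fin j) {e} → e ∈ S →
            (∀ {i'} → i' ≢ i → VertexDisjoint G e (edge M i')) → Matching j
  replace {j} M i {e} e∈S avoids = record { edge = edge′ ; inS = inS′ ; disjoint = disjoint′ }
    where
    edge′ : Fin j → Fin m
    edge′ i' with i' ≟ i
    ... | yes _ = e
    ... | no _  = edge M i'
    inS′ : ∀ i' → edge′ i' ∈ S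
    inS′ i' with i' ≟ i
    ... | yes _ = e∈S
    ... | no _  = inS M i'
    disjoint′ : ∀ {a b} → a ≢ b → VertexDisjoint G (edge′ a) (edge′ b)
    disjoint′ {a} {b} a≢b with a ≟ i | b ≟ i
    ... | yes refl | yes refl = ⊥-elim (a≢b refl)
    ... | yes refl | no b≢i   = avoids b≢i
    ... | no a≢i   | yes refl = disjoint-sym (avoids a≢i)
    ... | no _     | no _     = disjoint M a≢b

  avoids-replace : ∀ {j} (M : Matching j) (i : Fin j) {e} (e∈S : e ∈ S)
    (avoids : ∀ {i'} → i' ≢ i → VertexDisjoint G e (edge M i')) {f} →
    VertexDisjoint G f e → (∀ {i'} → i' ≢ i → VertexDisjoint G f (edge M i')) →
    ∀ i' → VertexDisjoint G f (edge (replace M i e∈S avoids) i')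
  avoids-replace M i e∈S avoids f∩e=∅ f-avoids i' with i' ≟ i
  ... | yes _   = f∩e=∅
  ... | no i'≢i = f-avoids i'≢i

  χ : Fin m → ℕ
  χ e = 𝟙 (e ∈? S)

  module Around {j} (M : Matching j) where

    u v : Fin j → Fin n
    u i = end₁ (edge M i)
    v i = end₂ (edge M i)

    Covered : Fin n → Set
    Covered x = ∃ λ i → Inc x (edge M i)

    covered? : ∀ x → Dec (Covered x)
    covered? x = any? (λ i → incident? x (edge M i))

    u-covered : ∀ i → Covered (u i)
    u-covered i = i , inj₁ refl

    v-covered : ∀ i → Covered (v i)
    v-covered i = i , inj₂ refl

    Pendant : Fin n → Fin m → Set
    Pendant x e = ∃ λ y → HasEnds e x y × ¬ Covered y

    pendant? : ∀ x e → Dec (Pendant x e)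
    pendant? x e = any? (λ y → hasEnds? e x y ×-dec ¬? (covered? y))

    far : ∀ {x e} → Pendant x e → Fin n
    far = proj₁

    pendant-incident : ∀ {x e} → Pendant x e → Inc x e
    pendant-incident (_ , ends , _) = ends-incident₁ ends

    far-incident : ∀ {x e} (p : Pendant x e) → Inc (far p) e
    far-incident (_ , ends , _) = ends-incident₂ ends

    pendant-avoids : ∀ {x e i} → Pendant x e → Inc x (edge M i) →
                     ∀ {i'} → i' ≢ i → VertexDisjoint G e (edge M i')
    pendant-avoids {x} (y , ends , y-free) x∈i {i'} i'≢i (z , z∈e , z∈i') with ends-only ends z∈e
    ... | inj₁ refl = disjoint M i'≢i (z , z∈i' , x∈i)
    ... | inj₂ refl = y-free (i' , z∈i')

    no-double-pendant : ∀ i e → ¬ (Pendant (u i) e × Pendant (v i) e)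
    no-double-pendant i e ((y , ends , y-free) , q) with ends-only ends (pendant-incident q)
    ... | inj₁ v≡u = loopless (edge M i) (sym v≡u)
    ... | inj₂ refl = y-free (v-covered i)

    free-edge-avoids : ∀ {e} → ¬ Covered (end₁ e) → ¬ Covered (end₂ e) →
                       ∀ i → VertexDisjoint G e (edge M i)
    free-edge-avoids free₁ free₂ i (x , inj₁ refl , x∈i) = free₁ (i , x∈i)
    free-edge-avoids free₁ free₂ i (x , inj₂ refl , x∈i) = free₂ (i , x∈i)

    -- Two edges pendant at the two ends of uᵢvᵢ with distinct far ends are
    -- disjoint, so they can replace uᵢvᵢ and M grows.
    switch : ∀ {i e₁ e₂} → e₁ ∈ S → e₂ ∈ S →
             (p : Pendant (u i) e₁) (q : Pendant (v i) e₂) → far p ≢ far q →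
             Matching (suc j)
    switch {i} {e₁} {e₂} e₁∈S e₂∈S p@(y₁ , ends₁ , free₁) q@(y₂ , ends₂ , free₂) far≢ =
      extend M′ e₂∈S
        (avoids-replace M i e₁∈S e₁-avoids (disjoint-sym e₁∩e₂=∅) (pendant-avoids q (inj₂ refl)))
      where
      e₁-avoids : ∀ {i'} → i' ≢ i → VertexDisjoint G e₁ (edge M i')
      e₁-avoids = pendant-avoids p (inj₁ refl)
      M′ : Matching j
      M′ = replace M i e₁∈S e₁-avoids
      e₁∩e₂=∅ : VertexDisjoint G e₁ e₂
      e₁∩e₂=∅ (x , x∈e₁ , x∈e₂) with ends-only ends₁ x∈e₁ | ends-only ends₂ x∈e₂
      ... | inj₁ refl | inj₁ u≡v  = loopless (edge M i) u≡v
      ... | inj₁ refl | inj₂ refl = free₂ (u-covered i)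
      ... | inj₂ refl | inj₁ refl = free₁ (v-covered i)
      ... | inj₂ refl | inj₂ refl = far≢ refl

    meet-or-grow : ∀ {i e₁ e₂} → e₁ ∈ S → e₂ ∈ S →
                   (p : Pendant (u i) e₁) (q : Pendant (v i) e₂) →
                   far p ≡ far q ⊎ Matching (suc j)
    meet-or-grow e₁∈S e₂∈S p q with far p ≟ far q
    ... | yes same = inj₁ same
    ... | no far≢  = inj₂ (switch e₁∈S e₂∈S p q far≢)

    Centre : Fin j → Fin n → Set
    Centre i w = ∀ e → e ∈ S → Pendant (u i) e ⊎ Pendant (v i) e → Inc w e

    -- Either the pendant S-edges at uᵢvᵢ have a centre, or M grows: with no
    -- pendant S-edge at uᵢ (or vᵢ) the other end is a centre; otherwise any
    -- two pendant edges at opposite ends must share their far end.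
    centre-or-grow : ∀ i → ∃ (Centre i) ⊎ Matching (suc j)
    centre-or-grow i with any? (λ e → (e ∈? S) ×-dec pendant? (u i) e)
                        | any? (λ e → (e ∈? S) ×-dec pendant? (v i) e)
    ... | no none-at-u | _ =
      inj₁ (v i , λ e e∈S → [ (λ p → ⊥-elim (none-at-u (e , e∈S , p))) , pendant-incident ]′)
    ... | yes _ | no none-at-v =
      inj₁ (u i , λ e e∈S → [ pendant-incident , (λ q → ⊥-elim (none-at-v (e , e∈S , q))) ]′)
    ... | yes (e₁ , e₁∈S , p) | yes (e₂ , e₂∈S , q) with meet-or-grow e₁∈S e₂∈S p q
    ...   | inj₂ grown = inj₂ grown
    ...   | inj₁ meet  = [ (λ centre → inj₁ (far q , centre)) , inj₂ ]′ (all-or-witness through-far)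
      where
      pendant-through-far : ∀ {e} → e ∈ S → Pendant (u i) e ⊎ Pendant (v i) e →
                            Inc (far q) e ⊎ Matching (suc j)
      pendant-through-far e∈S (inj₁ p′) with meet-or-grow e∈S e₂∈S p′ q
      ... | inj₁ same  = inj₁ (subst (λ z → Inc z _) same (far-incident p′))
      ... | inj₂ grown = inj₂ grown
      pendant-through-far e∈S (inj₂ q′) with meet-or-grow e₁∈S e∈S p q′
      ... | inj₁ same  = inj₁ (subst (λ z → Inc z _) (sym (trans (sym meet) same)) (far-incident q′))
      ... | inj₂ grown = inj₂ grown
      through-far : ∀ e → (e ∈ S → Pendant (u i) e ⊎ Pendant (v i) e → Inc (far q) e)
                          ⊎ Matching (suc j)
      through-far e with (e ∈? S) ×-dec (pendant? (u i) e ⊎-dec pendant? (v i) e)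
      ... | no ¬pendant = inj₁ (λ e∈S pend → ⊥-elim (¬pendant (e∈S , pend)))
      ... | yes (e∈S , pend) = [ (λ through → inj₁ (λ _ _ → through)) , inj₂ ]′
                                 (pendant-through-far e∈S pend)

    Dominating : Set
    Dominating = ∀ e → e ∈ S → Covered (end₁ e) ⊎ Covered (end₂ e)

    Stable : Set
    Stable = Dominating × (∀ i → ∃ (Centre i))

    stable-or-grow : Stable ⊎ Matching (suc j)
    stable-or-grow with any? (λ e → (e ∈? S) ×-dec (¬? (covered? (end₁ e)) ×-dec ¬? (covered? (end₂ e))))
    ... | yes (e , e∈S , free₁ , free₂) = inj₂ (extend M e∈S (free-edge-avoids free₁ free₂))
    ... | no no-free-edge = [ (λ centres → inj₁ (dominating , centres)) , inj₂ ]′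
                              (all-or-witness centre-or-grow)
      where
      dominating : Dominating
      dominating e e∈S with covered? (end₁ e) | covered? (end₂ e)
      ... | yes c₁ | _      = inj₁ c₁
      ... | no _   | yes c₂ = inj₂ c₂
      ... | no f₁  | no f₂  = ⊥-elim (no-free-edge (e , e∈S , f₁ , f₂))

    π : Fin n → Fin m → ℕ
    π x e = 𝟙 (pendant? x e)

    incidence pendancy weight : Fin j → Fin m → ℕ
    incidence i e = ι (u i) e + ι (v i) e
    pendancy  i e = π (u i) e + π (v i) e
    weight    i e = incidence i e + pendancy i e

    end-weight : ∀ {x i} e → Inc x (edge M i) → ι x e + π x e ≤ weight i e
    end-weight {i = i} e (inj₁ refl) = +-mono-≤ (m≤m+n (ι (u i) e) _) (m≤m+n (π (u i) e) _)
    end-weight {i = i} e (inj₂ refl) = +-mono-≤ (m≤n+m (ι (v i) e) (ι (u i) e)) (m≤n+m (π (v i) e) (π (u i) e))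

    meeting-weight : ∀ {x i e} → Inc x (edge M i) → Inc x e → 1 ≤ weight i e
    meeting-weight {x} {i} {e} x∈i x∈e =
      ≤-trans (≤-trans (≤-reflexive (sym (𝟙-yes (incident? x e) x∈e))) (m≤m+n _ _))
              (end-weight e x∈i)

    both-incident : ∀ {i e} → Inc (u i) e → Inc (v i) e → 2 ≤ weight i e
    both-incident {i} {e} u∈e v∈e =
      ≤-trans (≤-reflexive (sym (cong₂ _+_ (𝟙-yes (incident? (u i) e) u∈e)
                                          (𝟙-yes (incident? (v i) e) v∈e))))
              (m≤m+n _ _)

    parallel-weight : ∀ {x y i e} → x ≢ y → Inc x (edge M i) → Inc y (edge M i) →
                      Inc x e → Inc y e → 2 ≤ weight i e
    parallel-weight x≢y (inj₁ refl) (inj₁ refl) _ _ = ⊥-elim (x≢y refl)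
    parallel-weight x≢y (inj₂ refl) (inj₂ refl) _ _ = ⊥-elim (x≢y refl)
    parallel-weight _ (inj₁ refl) (inj₂ refl) u∈e v∈e = both-incident u∈e v∈e
    parallel-weight _ (inj₂ refl) (inj₁ refl) v∈e u∈e = both-incident u∈e v∈e

    -- Covering lemma: an edge xy with x covered gets total weight at least
    -- 2 — from x's matching edge twice if y is uncovered (e is pendant at x)
    -- or if y lies on the same matching edge, else once from each of the two.
    covered-end-weight : ∀ {e x y} → HasEnds e x y → Covered x → 2 ≤ sum (λ i → weight i e)
    covered-end-weight {e} {x} {y} ends (i , x∈i) with covered? y
    ... | no y-free =
      ≤-trans (≤-reflexive (sym (cong₂ _+_ (𝟙-yes (incident? x e) (ends-incident₁ ends))
                                          (𝟙-yes (pendant? x e) (y , ends , y-free)))))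
              (≤-trans (end-weight e x∈i) (term≤sum (λ i → weight i e) i))
    ... | yes (i' , y∈i') with i ≟ i'
    ...   | yes refl =
      ≤-trans (parallel-weight (ends-distinct ends) x∈i y∈i' (ends-incident₁ ends) (ends-incident₂ ends))
              (term≤sum (λ i → weight i e) i)
    ...   | no i≢i' =
      ≤-trans (+-mono-≤ (meeting-weight x∈i (ends-incident₁ ends)) (meeting-weight y∈i' (ends-incident₂ ends)))
              (two-terms≤sum (λ i → weight i e) i≢i')

    covering : Dominating → ∀ e → e ∈ S → 2 ≤ sum (λ i → weight i e)
    covering dominating e e∈S =
      [ covered-end-weight (inj₁ (refl , refl)) , covered-end-weight (inj₂ (refl , refl)) ]′
        (dominating e e∈S)

    pendant-load : ∀ {Δ} → MaxDegree≤ G Δ → ∀ {i w} → Centre i w →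
                   sum (λ e → χ e * pendancy i e) ≤ Δ
    pendant-load maxdeg {i} {w} centre = ≤-trans (sum-mono at-most-ι) (incidences≤Δ maxdeg w)
      where
      at-most-ι : ∀ e → χ e * pendancy i e ≤ ι w e
      at-most-ι e =
        ≤-trans (𝟙-guard (e ∈? S) (λ e∈S →
                   𝟙-+-≤ (pendant? (u i) e) (pendant? (v i) e) (incident? w e)
                         (no-double-pendant i e) (centre e e∈S ∘ inj₁) (centre e e∈S ∘ inj₂)))
                (𝟙-*-≤ (e ∈? S) (ι w e))

    load : ∀ {Δ} → MaxDegree≤ G Δ → ∀ {i w} → Centre i w → sum (λ e → χ e * weight i e) ≤ 3 * Δ
    load {Δ} maxdeg {i} centre = begin
      sum (λ e → χ e * weight i e)
        ≤⟨ sum-mono drop-χ ⟩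
      sum (λ e → incidence i e + χ e * pendancy i e)
        ≡⟨ ∑-distrib-+ (λ e → ι (u i) e + ι (v i) e) _ ⟩
      sum (λ e → ι (u i) e + ι (v i) e) + sum (λ e → χ e * pendancy i e)
        ≡⟨ cong (_+ sum (λ e → χ e * pendancy i e)) (∑-distrib-+ (ι (u i)) (ι (v i))) ⟩
      (sum (ι (u i)) + sum (ι (v i))) + sum (λ e → χ e * pendancy i e)
        ≤⟨ +-mono-≤ (+-mono-≤ (incidences≤Δ maxdeg (u i)) (incidences≤Δ maxdeg (v i)))
                    (pendant-load maxdeg centre) ⟩
      (Δ + Δ) + Δ
        ≡⟨ trans (+-assoc Δ Δ Δ) (cong (λ t → Δ + (Δ + t)) (sym (+-identityʳ Δ))) ⟩
      3 * Δ ∎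
      where
      open ≤-Reasoning
      drop-χ : ∀ e → χ e * weight i e ≤ incidence i e + χ e * pendancy i e
      drop-χ e = ≤-trans (≤-reflexive (*-distribˡ-+ (χ e) _ _)) (+-monoˡ-≤ (χ e * pendancy i e) (𝟙-*-≤ (e ∈? S) (incidence i e)))

    double-count : ∀ {Δ} → MaxDegree≤ G Δ → Stable → 2 * ∣ S ∣ ≤ j * (3 * Δ)
    double-count {Δ} maxdeg (dominating , centres) = begin
      2 * ∣ S ∣                                 ≡⟨ cong (2 *_) (∣∣-as-sum S) ⟩
      2 * sum χ                                 ≡⟨ *-distribˡ-sum 2 χ ⟩
      sum (λ e → 2 * χ e)                       ≤⟨ sum-mono twice-covered ⟩
      sum (λ e → χ e * sum (λ i → weight i e))  ≡⟨ sum-cong-≗ (λ e → *-distribˡ-sum (χ e) (λ i → weight i e)) ⟩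
      sum (λ e → sum (λ i → χ e * weight i e))  ≡⟨ ∑-comm (λ e i → χ e * weight i e) ⟩
      sum (λ i → sum (λ e → χ e * weight i e))  ≤⟨ sum-≤-* (3 * Δ) (λ i → load maxdeg (proj₂ (centres i))) ⟩
      j * (3 * Δ)                               ∎
      where
      open ≤-Reasoning
      twice-covered : ∀ e → 2 * χ e ≤ χ e * sum (λ i → weight i e)
      twice-covered e = ≤-trans (≤-reflexive (*-comm 2 (χ e))) (𝟙-guard (e ∈? S) (covering dominating e))

  -- If S has no matching of size k, repeatedly growing the empty matching
  -- stops at a stable matching with fewer than k edges.
  stable-matching-below : ∀ {k} → ¬ Matching k →
                          ∃[ j ] j < k × Σ (Matching j) Around.Stable
  stable-matching-below {k} no-k-matching = grow k refl empty
    where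
    grow : ∀ d {j} → j + d ≡ k → Matching j → ∃[ j ] j < k × Σ (Matching j) Around.Stable
    grow zero    {j} j+0≡k M =
      ⊥-elim (no-k-matching (subst Matching (trans (sym (+-identityʳ j)) j+0≡k) M))
    grow (suc d) {j} j+d≡k M with Around.stable-or-grow M
    ... | inj₁ stable = j , ≤-trans (m<m+n j (s≤s z≤n)) (≤-reflexive j+d≡k) , M , stable
    ... | inj₂ M′     = grow d (trans (sym (+-suc j d)) j+d≡k) M′

below-k-bound : ∀ {j k} Δ → j < k → j * (3 * Δ) ≤ 3 * ((k ∸ 1) * Δ)
below-k-bound {j} {suc k′} Δ (s≤s j≤k′) = begin
  j * (3 * Δ)   ≤⟨ *-monoˡ-≤ (3 * Δ) j≤k′ ⟩
  k′ * (3 * Δ)  ≡⟨ *-comm k′ (3 * Δ) ⟩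
  3 * Δ * k′    ≡⟨ *-assoc 3 Δ k′ ⟩
  3 * (Δ * k′)  ≡⟨ cong (3 *_) (*-comm Δ k′) ⟩
  3 * (k′ * Δ)  ∎
  where open ≤-Reasoning

proposition7p3 : (G : Multigraph) (Δ k : ℕ) → MaxDegree≤ G Δ →
    ¬ HasJoinedMatching G k →
    (S : Subset (Multigraph.m G)) → StrongClique G S →
    2 * ∣ S ∣ ≤ 3 * ((k ∸ 1) * Δ)
-- A matching of size k in S would be a joined matching, so growing stops at
-- a stable matching of some size j < k; double counting bounds 2|S| by 3jΔ.
proposition7p3 G Δ k maxdeg no-joined-matching S clique
  with Matchings.stable-matching-below G S
         (no-joined-matching ∘ Matchings.clique-matching-joined G S clique)
... | j , j<k , M , stable =
  ≤-trans (Matchings.Around.double-count G S M maxdeg stable) (below-k-bound Δ j<k)
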